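{- Let $q=p^e$, where $p$ is an odd prime and $e$ is a positive integer. Let $\Gamma(q)$ be the bipartite graph with parts $P=\mathbb F_q^5$ (points $(p)=(p_1,\dots,p_5)$) and $L=\mathbb F_q^5$ (lines $[\ell]=[\ell_1,\dots,\ell_5]$), where $(p)$ is adjacent to $[\ell]$ if and only if $p_2+\ell_2=p_1\ell_1$, $p_3+\ell_3=p_1\ell_1^2$, $p_4+\ell_4=p_1^2\ell_1$, $p_5+\ell_5=p_1^2\ell_1^2$. Then $\Gamma(q)$ is isomorphic to $D(5,q)$.
   Context: $D(5,q)$ is the bipartite graph whose two parts are two disjoint copies of $\mathbb F_q^5$, points $(p)=(p_1,\dots,p_5)$ and lines $[\ell]=[\ell_1,\dots,\ell_5]$, where $(p)$ is adjacent to $[\ell]$ if and only if $p_2+\ell_2=p_1\ell_1$, $p_3+\ell_3=p_1\ell_2$, $p_4+\ell_4=p_2\ell_1$, $p_5+\ell_5=p_3\ell_1$. -}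

module Defs where

open import Level using (Level; _⊔_) renaming (suc to lsuc)
open import Data.Nat using (ℕ)
open import Data.Fin using (Fin)
open import Data.Product using (_×_; ∃)
open import Data.Sum using (_⊎_; inj₁; inj₂)
open import Data.Empty using (⊥)
open import Relation.Nullary using (¬_)
open import Relation.Binary.PropositionalEquality using (_≡_)
open import Algebra.Bundles using (CommutativeRing)
open import Function.Bundles using (_⇔_)

record Field (c ℓ : Level) : Set (lsuc (c ⊔ ℓ)) where
  field
    commutativeRing′ : CommutativeRing c ℓ
  open CommutativeRing commutativeRing′ public
  field
    1≉0     : ¬ (1# ≈ 0#)
    inverse : ∀ x → ¬ (x ≈ 0#) → ∃ λ y → (x * y) ≈ 1#

HasCard : ∀ {c ℓ} → Field c ℓ → ℕ → Set (c ⊔ ℓ)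
HasCard F n = ∃ λ (f : Fin n → Carrier) →
    (∀ i j → f i ≈ f j → i ≡ j) × (∀ x → ∃ λ i → f i ≈ x)
  where open Field F

module _ {c ℓ} (F : Field c ℓ) where
  open Field F

  record F5 : Set c where
    constructor ⟨_,_,_,_,_⟩
    field
      x₁ x₂ x₃ x₄ x₅ : Carrier

  _≈5_ : F5 → F5 → Set ℓ
  ⟨ a₁ , a₂ , a₃ , a₄ , a₅ ⟩ ≈5 ⟨ b₁ , b₂ , b₃ , b₄ , b₅ ⟩ =
    (a₁ ≈ b₁) × (a₂ ≈ b₂) × (a₃ ≈ b₃) × (a₄ ≈ b₄) × (a₅ ≈ b₅)

  -- vertex set of a bipartite graph with parts P = F^5 (inj₁) and L = F^5 (inj₂)
  Vertex : Set c
  Vertex = F5 ⊎ F5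

  _≈V_ : Vertex → Vertex → Set ℓ
  inj₁ a ≈V inj₁ b = a ≈5 b
  inj₂ a ≈V inj₂ b = a ≈5 b
  _ ≈V _ = Lift′
    where Lift′ : Set ℓ
          Lift′ = Level.Lift ℓ ⊥

  Adjacency : (F5 → F5 → Set ℓ) → Vertex → Vertex → Set ℓ
  Adjacency I (inj₁ p) (inj₂ l) = I p l
  Adjacency I (inj₂ l) (inj₁ p) = I p l
  Adjacency I _ _ = Level.Lift ℓ ⊥

  IncD : F5 → F5 → Set ℓ
  IncD ⟨ p₁ , p₂ , p₃ , p₄ , p₅ ⟩ ⟨ l₁ , l₂ , l₃ , l₄ , l₅ ⟩ =
    ((p₂ + l₂) ≈ (p₁ * l₁)) × ((p₃ + l₃) ≈ (p₁ * l₂)) ×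
    ((p₄ + l₄) ≈ (p₂ * l₁)) × ((p₅ + l₅) ≈ (p₃ * l₁))

  IncΓ : F5 → F5 → Set ℓ
  IncΓ ⟨ p₁ , p₂ , p₃ , p₄ , p₅ ⟩ ⟨ l₁ , l₂ , l₃ , l₄ , l₅ ⟩ =
    ((p₂ + l₂) ≈ (p₁ * l₁)) × ((p₃ + l₃) ≈ (p₁ * (l₁ * l₁))) ×
    ((p₄ + l₄) ≈ ((p₁ * p₁) * l₁)) × ((p₅ + l₅) ≈ ((p₁ * p₁) * (l₁ * l₁)))

  D5 Γ : Vertex → Vertex → Set ℓ
  D5 = Adjacency IncD
  Γ  = Adjacency IncΓ

  Isomorphic : (Vertex → Vertex → Set ℓ) → (Vertex → Vertex → Set ℓ) → Set (c ⊔ ℓ)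
  Isomorphic A B = ∃ λ (φ : Vertex → Vertex) →
    (∀ u v → u ≈V v → φ u ≈V φ v) ×
    (∀ u v → φ u ≈V φ v → u ≈V v) ×
    (∀ w → ∃ λ u → φ u ≈V w) ×
    (∀ u v → A u v ⇔ B (φ u) (φ v))

-- Let h = 1/2; it exists because q is odd, a field of characteristic 2 having even order
-- (x ↦ x + 1 is then a fixed-point-free involution of it).  The isomorphism Γ(q) → D(5,q) is
--   (a₁, a₂, a₃, a₄, a₅) ↦ (a₁, a₂, a₄ − a₁a₂, a₃, h(a₅ − a₂²))          on points,
--   [b₁, b₂, b₃, b₄, b₅] ↦ [b₁, b₂, b₄, b₃ − b₁b₂, h(b₅ + b₂²) − b₁b₄]   on lines.
-- Both equation systems share the first equation p₂ + ℓ₂ = p₁ℓ₁.  Modulo it, the second and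
-- third equations of D(5,q) for the images are the third and second equations of Γ(q), and
-- modulo the first and third, the fourth one is h times the fourth equation of Γ(q).
module Submission where

open import Defs
open import Algebra.Bundles using (CommutativeRing)
open import Data.Bool.Base using (Bool; if_then_else_)
open import Data.Fin.Base using (Fin)
open import Data.Fin.Permutation using (Permutation; permutation)
open import Data.Fin.Properties using (_<?_; <-cmp)
open import Data.Integer.Base as ℤ using (ℤ; +_; -[1+_]; ∣_∣; sign; _◃_; _⊖_)
import Data.Integer.Properties as ℤₚ
open import Data.Maybe.Base using (Maybe; just; nothing)
open import Data.Nat.Base as ℕ using (ℕ; zero; suc; _^_; _≥_; nonTrivial⇒≢1)
open import Data.Nat.Divisibility using (_∣_; divides; ∣1⇒≡1)
open import Data.Nat.Primality using (Prime; euclidsLemma; prime[2]; prime⇒nonTrivial; prime⇒irreducible)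
import Data.Nat.Properties as ℕₚ
open import Data.Product.Base using (∃; _,_; proj₁; proj₂)
open import Data.Sign.Base as Sign using (Sign)
open import Data.Sum.Base using (inj₁; inj₂)
open import Function.Base using (id; _∘_)
open import Function.Bundles using (_⇔_; mk⇔)
open import Level using (Level; _⊔_)
open import Relation.Binary.Definitions using (tri<; tri≈; tri>)
open import Relation.Binary.PropositionalEquality as ≡ using (_≡_; _≢_)
open import Relation.Nullary.Decidable using (yes; no; does; dec-true; dec-false)
open import Relation.Nullary.Negation using (¬_; contradiction)
import Algebra.Solver.Ring.AlmostCommutativeRing as ACR
open import Algebra.Properties.CommutativeMonoid.Sum ℕₚ.+-0-commutativeMonoid
  using (sum; sum-cong-≗; ∑-distrib-+; sum-permute)

-- Algebra.Solver.Ring needs coefficients with decidable equality; ℤ acts on R through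
-- n ↦ n · 1#.  The optimised _×_ makes fromℤ (+ 1) reduce to 1#, so that the constant
-- con (+ 1) in a solved equation is literally 1#.
module IntegerCoefficientRingSolver {c ℓ} (R : CommutativeRing c ℓ) where
  open CommutativeRing R
  open import Algebra.Properties.Ring ring using (-‿distribˡ-*; -‿distribʳ-*; -‿involutive; -0#≈0#)
  open import Algebra.Properties.AbelianGroup +-abelianGroup using (⁻¹-∙-comm)
  open import Algebra.Properties.Semiring.Mult.TCOptimised semiring using (_×_; ×-homo-+; ×1-homo-*)
  open import Algebra.Solver.CommutativeMonoid +-commutativeMonoid using (_⊕_; _⊜_) renaming (solve to +-solve)
  open import Relation.Binary.Reasoning.Setoid setoid

  fromℕ : ℕ → Carrier
  fromℕ n = n × 1#

  fromℤ : ℤ → Carrier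
  fromℤ (+ n)    = fromℕ n
  fromℤ -[1+ n ] = - fromℕ (suc n)

  signed : Sign → Carrier → Carrier
  signed Sign.+ x = x
  signed Sign.- x = - x

  signed-cong : ∀ s {x y} → x ≈ y → signed s x ≈ signed s y
  signed-cong Sign.+ x≈y = x≈y
  signed-cong Sign.- x≈y = -‿cong x≈y

  signed-* : ∀ s t x y → signed (s Sign.* t) (x * y) ≈ signed s x * signed t y
  signed-* Sign.+ Sign.+ x y = refl
  signed-* Sign.+ Sign.- x y = -‿distribʳ-* x y
  signed-* Sign.- Sign.+ x y = -‿distribˡ-* x y
  signed-* Sign.- Sign.- x y = begin
    x * y         ≈⟨ -‿involutive (x * y) ⟨
    - (- (x * y)) ≈⟨ -‿cong (-‿distribˡ-* x y) ⟩
    - (- x * y)   ≈⟨ -‿distribʳ-* (- x) y ⟩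
    - x * - y     ∎

  fromℤ-◃ : ∀ s n → fromℤ (s ◃ n) ≈ signed s (fromℕ n)
  fromℤ-◃ Sign.+ zero    = refl
  fromℤ-◃ Sign.- zero    = sym -0#≈0#
  fromℤ-◃ Sign.+ (suc n) = refl
  fromℤ-◃ Sign.- (suc n) = refl

  fromℤ-signAbs : ∀ i → fromℤ i ≈ signed (sign i) (fromℕ ∣ i ∣)
  fromℤ-signAbs (+ zero)    = refl
  fromℤ-signAbs (+ (suc n)) = refl
  fromℤ-signAbs -[1+ n ]    = refl

  fromℤ-* : ∀ i j → fromℤ (i ℤ.* j) ≈ fromℤ i * fromℤ j
  fromℤ-* i j = begin
    fromℤ (s ◃ ∣ i ∣ ℕ.* ∣ j ∣)                                    ≈⟨ fromℤ-◃ s (∣ i ∣ ℕ.* ∣ j ∣) ⟩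
    signed s (fromℕ (∣ i ∣ ℕ.* ∣ j ∣))                             ≈⟨ signed-cong s (×1-homo-* ∣ i ∣ ∣ j ∣) ⟩
    signed s (fromℕ ∣ i ∣ * fromℕ ∣ j ∣)                           ≈⟨ signed-* (sign i) (sign j) _ _ ⟩
    signed (sign i) (fromℕ ∣ i ∣) * signed (sign j) (fromℕ ∣ j ∣) ≈⟨ *-cong (fromℤ-signAbs i) (fromℤ-signAbs j) ⟨
    fromℤ i * fromℤ j                                               ∎
    where s = sign i Sign.* sign j

  [1+x]-[1+y]≈x-y : ∀ x y → (1# + x) - (1# + y) ≈ x - y
  [1+x]-[1+y]≈x-y x y = begin
    (1# + x) + - (1# + y)   ≈⟨ +-congˡ (⁻¹-∙-comm 1# y) ⟨
    (1# + x) + (- 1# + - y) ≈⟨ +-solve 4 (λ u x u′ y → (u ⊕ x) ⊕ (u′ ⊕ y) ⊜ (u ⊕ u′) ⊕ (x ⊕ y))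
                                 refl 1# x (- 1#) (- y) ⟩
    (1# + - 1#) + (x + - y) ≈⟨ +-congʳ (-‿inverseʳ 1#) ⟩
    0# + (x - y)            ≈⟨ +-identityˡ (x - y) ⟩
    x - y                   ∎

  fromℤ-⊖ : ∀ m n → fromℤ (m ⊖ n) ≈ fromℕ m - fromℕ n
  fromℤ-⊖ zero    zero    = sym (-‿inverseʳ 0#)
  fromℤ-⊖ (suc m) zero    = sym (trans (+-congˡ -0#≈0#) (+-identityʳ _))
  fromℤ-⊖ zero    (suc n) = sym (+-identityˡ _)
  fromℤ-⊖ (suc m) (suc n) = begin
    fromℤ (suc m ⊖ suc n)           ≡⟨ ≡.cong fromℤ (ℤₚ.[1+m]⊖[1+n]≡m⊖n m n) ⟩
    fromℤ (m ⊖ n)                   ≈⟨ fromℤ-⊖ m n ⟩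
    fromℕ m - fromℕ n               ≈⟨ [1+x]-[1+y]≈x-y (fromℕ m) (fromℕ n) ⟨
    (1# + fromℕ m) - (1# + fromℕ n) ≈⟨ +-cong (×-homo-+ 1# 1 m) (-‿cong (×-homo-+ 1# 1 n)) ⟨
    fromℕ (suc m) - fromℕ (suc n)   ∎

  fromℤ-+ : ∀ i j → fromℤ (i ℤ.+ j) ≈ fromℤ i + fromℤ j
  fromℤ-+ (+ m)    (+ n)    = ×-homo-+ 1# m n
  fromℤ-+ (+ m)    -[1+ n ] = fromℤ-⊖ m (suc n)
  fromℤ-+ -[1+ m ] (+ n)    = trans (fromℤ-⊖ n (suc m)) (+-comm _ _)
  fromℤ-+ -[1+ m ] -[1+ n ] = begin
    - fromℕ (suc (suc (m ℕ.+ n)))     ≡⟨ ≡.cong (λ k → - fromℕ (suc k)) (ℕₚ.+-suc m n) ⟨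
    - fromℕ (suc m ℕ.+ suc n)         ≈⟨ -‿cong (×-homo-+ 1# (suc m) (suc n)) ⟩
    - (fromℕ (suc m) + fromℕ (suc n)) ≈⟨ ⁻¹-∙-comm _ _ ⟨
    - fromℕ (suc m) + - fromℕ (suc n) ∎

  fromℤ-neg : ∀ i → fromℤ (ℤ.- i) ≈ - fromℤ i
  fromℤ-neg (+ zero)    = sym -0#≈0#
  fromℤ-neg (+ (suc n)) = refl
  fromℤ-neg -[1+ n ]    = sym (-‿involutive _)

  fromℤ-homomorphism : ℤ.+-*-rawRing ACR.-Raw-AlmostCommutative⟶ ACR.fromCommutativeRing R
  fromℤ-homomorphism = record
    { ⟦_⟧    = fromℤ
    ; +-homo = fromℤ-+
    ; *-homo = fromℤ-*
    ; -‿homo = fromℤ-neg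
    ; 0-homo = refl
    ; 1-homo = refl
    }

  fromℤ-≟ : ∀ i j → Maybe (fromℤ i ≈ fromℤ j)
  fromℤ-≟ i j with i ℤₚ.≟ j
  ... | yes ≡.refl = just refl
  ... | no _       = nothing

  open import Algebra.Solver.Ring ℤ.+-*-rawRing (ACR.fromCommutativeRing R) fromℤ-homomorphism fromℤ-≟
    public

∑[1]≡n : ∀ n → sum {n} (λ _ → 1) ≡ n
∑[1]≡n zero    = ≡.refl
∑[1]≡n (suc n) = ≡.cong suc (∑[1]≡n n)

-- Each pair {i, σ i} contains exactly one ascent (i < σ i), so n is twice the number of ascents.
fixedPointFree-involution⇒2∣n : ∀ {n} (σ : Fin n → Fin n) →
  (∀ i → σ (σ i) ≡ i) → (∀ i → σ i ≢ i) → 2 ∣ n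
fixedPointFree-involution⇒2∣n {n} σ σ-involutive σ-fixedPointFree =
  divides (sum ascent) (begin
    n                                     ≡⟨ ∑[1]≡n n ⟨
    sum {n} (λ _ → 1)                     ≡⟨ sum-cong-≗ ascent-pair ⟨
    sum (λ i → ascent i ℕ.+ ascent (σ i)) ≡⟨ ∑-distrib-+ ascent (ascent ∘ σ) ⟩
    sum ascent ℕ.+ sum (ascent ∘ σ)       ≡⟨ ≡.cong (sum ascent ℕ.+_) (sum-permute ascent σ-permutation) ⟨
    sum ascent ℕ.+ sum ascent             ≡⟨ ≡.cong (sum ascent ℕ.+_) (ℕₚ.+-identityʳ (sum ascent)) ⟨
    2 ℕ.* sum ascent                      ≡⟨ ℕₚ.*-comm 2 (sum ascent) ⟩
    sum ascent ℕ.* 2                      ∎)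
  where
  open ≡.≡-Reasoning

  fromBool : Bool → ℕ
  fromBool b = if b then 1 else 0

  ascent : Fin n → ℕ
  ascent i = fromBool (does (i <? σ i))

  ascent-σ : ∀ i → ascent (σ i) ≡ fromBool (does (σ i <? i))
  ascent-σ i = ≡.cong (λ j → fromBool (does (σ i <? j))) (σ-involutive i)

  ascent-pair : ∀ i → ascent i ℕ.+ ascent (σ i) ≡ 1
  ascent-pair i rewrite ascent-σ i with <-cmp i (σ i)
  ... | tri< i<σi _ σi≮i = ≡.cong₂ (λ x y → fromBool x ℕ.+ fromBool y)
                             (dec-true (i <? σ i) i<σi) (dec-false (σ i <? i) σi≮i)
  ... | tri≈ _ i≡σi _    = contradiction (≡.sym i≡σi) (σ-fixedPointFree i)
  ... | tri> i≮σi _ σi<i = ≡.cong₂ (λ x y → fromBool x ℕ.+ fromBool y)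
                             (dec-false (i <? σ i) i≮σi) (dec-true (σ i <? i) σi<i)

  σ-permutation : Permutation n n
  σ-permutation = permutation σ σ σ-involutive σ-involutive

prime∣m^n⇒prime∣m : ∀ {p} m n → Prime p → p ∣ m ^ n → p ∣ m
prime∣m^n⇒prime∣m m zero    p-prime p∣1 =
  contradiction (∣1⇒≡1 p∣1) (nonTrivial⇒≢1 {{prime⇒nonTrivial p-prime}})
prime∣m^n⇒prime∣m m (suc n) p-prime p∣m*mⁿ with euclidsLemma m (m ^ n) p-prime p∣m*mⁿ
... | inj₁ p∣m  = p∣m
... | inj₂ p∣mⁿ = prime∣m^n⇒prime∣m m n p-prime p∣mⁿ

oddPrime⇒2∤p^e : ∀ {p} e → Prime p → p ≢ 2 → ¬ 2 ∣ p ^ e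
oddPrime⇒2∤p^e {p} e p-prime p≢2 2∣p^e
  with prime⇒irreducible p-prime (prime∣m^n⇒prime∣m p e prime[2] 2∣p^e)
... | inj₁ ()
... | inj₂ 2≡p = p≢2 (≡.sym 2≡p)

module _ {c ℓ} (F : Field c ℓ) where
  open Field F
  open import Algebra.Properties.Group +-group using (identityʳ-unique)
  open import Relation.Binary.Reasoning.Setoid setoid

  1+1≈0⇒2∣card : ∀ {n} → HasCard F n → 1# + 1# ≈ 0# → 2 ∣ n
  1+1≈0⇒2∣card {n} (f , f-injective , f-surjective) 1+1≈0 =
    fixedPointFree-involution⇒2∣n σ σ-involutive σ-fixedPointFree
    where
    σ : Fin n → Fin n
    σ i = proj₁ (f-surjective (f i + 1#))

    f∘σ : ∀ i → f (σ i) ≈ f i + 1#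
    f∘σ i = proj₂ (f-surjective (f i + 1#))

    σ-involutive : ∀ i → σ (σ i) ≡ i
    σ-involutive i = f-injective _ _ (begin
      f (σ (σ i))     ≈⟨ f∘σ (σ i) ⟩
      f (σ i) + 1#    ≈⟨ +-congʳ (f∘σ i) ⟩
      (f i + 1#) + 1# ≈⟨ +-assoc (f i) 1# 1# ⟩
      f i + (1# + 1#) ≈⟨ +-congˡ 1+1≈0 ⟩
      f i + 0#        ≈⟨ +-identityʳ (f i) ⟩
      f i             ∎)

    σ-fixedPointFree : ∀ i → σ i ≢ i
    σ-fixedPointFree i σi≡i =
      1≉0 (identityʳ-unique (f i) 1# (trans (sym (f∘σ i)) (reflexive (≡.cong f σi≡i))))

  *-≈0 : ∀ x {y} → y ≈ 0# → x * y ≈ 0#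
  *-≈0 x y≈0 = trans (*-congˡ y≈0) (zeroʳ x)

  +-≈0 : ∀ {x y} → x ≈ 0# → y ≈ 0# → x + y ≈ 0#
  +-≈0 x≈0 y≈0 = trans (+-cong x≈0 y≈0) (+-identityʳ 0#)

  ≈+≈0⇒≈ : ∀ {x y z} → x ≈ y + z → z ≈ 0# → x ≈ y
  ≈+≈0⇒≈ {y = y} x≈y+z z≈0 = trans x≈y+z (trans (+-congˡ z≈0) (+-identityʳ y))

  ≈5-sym : ∀ {a b} → _≈5_ F a b → _≈5_ F b a
  ≈5-sym {⟨ _ , _ , _ , _ , _ ⟩} {⟨ _ , _ , _ , _ , _ ⟩} (e₁ , e₂ , e₃ , e₄ , e₅) =
    sym e₁ , sym e₂ , sym e₃ , sym e₄ , sym e₅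

  ≈5-trans : ∀ {a b d} → _≈5_ F a b → _≈5_ F b d → _≈5_ F a d
  ≈5-trans {⟨ _ , _ , _ , _ , _ ⟩} {⟨ _ , _ , _ , _ , _ ⟩} {⟨ _ , _ , _ , _ , _ ⟩}
    (e₁ , e₂ , e₃ , e₄ , e₅) (f₁ , f₂ , f₃ , f₄ , f₅) =
    trans e₁ f₁ , trans e₂ f₂ , trans e₃ f₃ , trans e₄ f₄ , trans e₅ f₅

  record Inverse₅ : Set (c ⊔ ℓ) where
    field
      to from   : F5 F → F5 F
      to-cong   : ∀ {a b} → _≈5_ F a b → _≈5_ F (to a) (to b)
      from-cong : ∀ {a b} → _≈5_ F a b → _≈5_ F (from a) (from b)
      from∘to   : ∀ a → _≈5_ F (from (to a)) a
      to∘from   : ∀ a → _≈5_ F (to (from a)) a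

    to-injective : ∀ {a b} → _≈5_ F (to a) (to b) → _≈5_ F a b
    to-injective {a} {b} to[a]≈to[b] =
      ≈5-trans (≈5-sym (from∘to a)) (≈5-trans (from-cong to[a]≈to[b]) (from∘to b))

  open Inverse₅

  isomorphic-via : ∀ {I J} (φ ψ : Inverse₅) →
    (∀ a b → I a b ⇔ J (to φ a) (to ψ b)) → Isomorphic F (Adjacency F I) (Adjacency F J)
  isomorphic-via {I} {J} φ ψ preserves = θ , θ-cong , θ-injective , θ-surjective , θ-adjacency
    where
    θ : Vertex F → Vertex F
    θ (inj₁ a) = inj₁ (to φ a)
    θ (inj₂ b) = inj₂ (to ψ b)

    θ-cong : ∀ u v → _≈V_ F u v → _≈V_ F (θ u) (θ v)
    θ-cong (inj₁ a) (inj₁ a′) a≈a′ = to-cong φ a≈a′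
    θ-cong (inj₁ a) (inj₂ b)  ()
    θ-cong (inj₂ b) (inj₁ a)  ()
    θ-cong (inj₂ b) (inj₂ b′) b≈b′ = to-cong ψ b≈b′

    θ-injective : ∀ u v → _≈V_ F (θ u) (θ v) → _≈V_ F u v
    θ-injective (inj₁ a) (inj₁ a′) θa≈θa′ = to-injective φ θa≈θa′
    θ-injective (inj₁ a) (inj₂ b)  ()
    θ-injective (inj₂ b) (inj₁ a)  ()
    θ-injective (inj₂ b) (inj₂ b′) θb≈θb′ = to-injective ψ θb≈θb′

    θ-surjective : ∀ w → ∃ λ u → _≈V_ F (θ u) w
    θ-surjective (inj₁ p) = inj₁ (from φ p) , to∘from φ p
    θ-surjective (inj₂ l) = inj₂ (from ψ l) , to∘from ψ l

    θ-adjacency : ∀ u v → Adjacency F I u v ⇔ Adjacency F J (θ u) (θ v)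
    θ-adjacency (inj₁ a) (inj₁ a′) = mk⇔ id id
    θ-adjacency (inj₁ a) (inj₂ b)  = preserves a b
    θ-adjacency (inj₂ b) (inj₁ a)  = preserves a b
    θ-adjacency (inj₂ b) (inj₂ b′) = mk⇔ id id

  module ExplicitIsomorphism (h : Carrier) (2h≈1 : (1# + 1#) * h ≈ 1#) where
    open IntegerCoefficientRingSolver commutativeRing′ using (solve; _:=_; _:+_; _:-_; _:*_; :-_; con)
    open import Algebra.Properties.Group +-group using ()
      renaming (x≈y⇒x∙y⁻¹≈ε to x≈y⇒x-y≈0; x∙y⁻¹≈ε⇒x≈y to x-y≈0⇒x≈y; //-cong₂ to -‿cong₂)

    -- Facts that rely on 2h = 1 are proved as polynomial identities modulo 2h − 1,
    -- which the ring solver can check.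
    2h-1 : Carrier
    2h-1 = (1# + 1#) * h - 1#

    2h-1≈0 : 2h-1 ≈ 0#
    2h-1≈0 = x≈y⇒x-y≈0 2h≈1

    ≈-mod-2h-1 : ∀ {x y} z → x ≈ y + z * 2h-1 → x ≈ y
    ≈-mod-2h-1 z x≈y+z[2h-1] = ≈+≈0⇒≈ x≈y+z[2h-1] (*-≈0 z 2h-1≈0)

    h*x≈0⇒x≈0 : ∀ {x} → h * x ≈ 0# → x ≈ 0#
    h*x≈0⇒x≈0 {x} hx≈0 = begin
      x                   ≈⟨ *-identityˡ x ⟨
      1# * x              ≈⟨ *-congʳ 2h≈1 ⟨
      ((1# + 1#) * h) * x ≈⟨ *-assoc (1# + 1#) h x ⟩
      (1# + 1#) * (h * x) ≈⟨ *-≈0 (1# + 1#) hx≈0 ⟩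
      0#                  ∎

    φₚ ψₚ φₗ ψₗ : F5 F → F5 F
    φₚ ⟨ a₁ , a₂ , a₃ , a₄ , a₅ ⟩ = ⟨ a₁ , a₂ , a₄ - a₁ * a₂ , a₃ , h * (a₅ - a₂ * a₂) ⟩
    ψₚ ⟨ p₁ , p₂ , p₃ , p₄ , p₅ ⟩ = ⟨ p₁ , p₂ , p₄ , p₃ + p₁ * p₂ , (1# + 1#) * p₅ + p₂ * p₂ ⟩
    φₗ ⟨ b₁ , b₂ , b₃ , b₄ , b₅ ⟩ = ⟨ b₁ , b₂ , b₄ , b₃ - b₁ * b₂ , h * (b₅ + b₂ * b₂) - b₁ * b₄ ⟩
    ψₗ ⟨ l₁ , l₂ , l₃ , l₄ , l₅ ⟩ = ⟨ l₁ , l₂ , l₄ + l₁ * l₂ , l₃ , (1# + 1#) * (l₅ + l₁ * l₃) - l₂ * l₂ ⟩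

    x-y+y≈x : ∀ x y → (x - y) + y ≈ x
    x-y+y≈x = solve 2 (λ x y → (x :- y) :+ y := x) refl

    x+y-y≈x : ∀ x y → (x + y) - y ≈ x
    x+y-y≈x = solve 2 (λ x y → (x :+ y) :- y := x) refl

    pointMap : Inverse₅
    pointMap = record
      { to        = φₚ
      ; from      = ψₚ
      ; to-cong   = λ { {⟨ _ , _ , _ , _ , _ ⟩} {⟨ _ , _ , _ , _ , _ ⟩} (e₁ , e₂ , e₃ , e₄ , e₅) →
                      e₁ , e₂ , -‿cong₂ e₄ (*-cong e₁ e₂) , e₃ , *-congˡ (-‿cong₂ e₅ (*-cong e₂ e₂)) }
      ; from-cong = λ { {⟨ _ , _ , _ , _ , _ ⟩} {⟨ _ , _ , _ , _ , _ ⟩} (e₁ , e₂ , e₃ , e₄ , e₅) →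
                      e₁ , e₂ , e₄ , +-cong e₃ (*-cong e₁ e₂) , +-cong (*-congˡ e₅) (*-cong e₂ e₂) }
      ; from∘to   = λ { ⟨ a₁ , a₂ , a₃ , a₄ , a₅ ⟩ →
                      refl , refl , refl , x-y+y≈x a₄ (a₁ * a₂) ,
                      ≈-mod-2h-1 (a₅ - a₂ * a₂) (ψₚφₚ₅ h a₅ (a₂ * a₂)) }
      ; to∘from   = λ { ⟨ p₁ , p₂ , p₃ , p₄ , p₅ ⟩ →
                      refl , refl , x+y-y≈x p₃ (p₁ * p₂) , refl , ≈-mod-2h-1 p₅ (φₚψₚ₅ h p₅ (p₂ * p₂)) }
      }
      where
      ψₚφₚ₅ : ∀ k x y → (1# + 1#) * (k * (x - y)) + y ≈ x + (x - y) * ((1# + 1#) * k - 1#)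
      ψₚφₚ₅ = solve 3 (λ k x y →
        con (+ 2) :* (k :* (x :- y)) :+ y := x :+ (x :- y) :* (con (+ 2) :* k :- con (+ 1))) refl

      φₚψₚ₅ : ∀ k x y → k * (((1# + 1#) * x + y) - y) ≈ x + x * ((1# + 1#) * k - 1#)
      φₚψₚ₅ = solve 3 (λ k x y →
        k :* ((con (+ 2) :* x :+ y) :- y) := x :+ x :* (con (+ 2) :* k :- con (+ 1))) refl

    lineMap : Inverse₅
    lineMap = record
      { to        = φₗ
      ; from      = ψₗ
      ; to-cong   = λ { {⟨ _ , _ , _ , _ , _ ⟩} {⟨ _ , _ , _ , _ , _ ⟩} (e₁ , e₂ , e₃ , e₄ , e₅) →
                      e₁ , e₂ , e₄ , -‿cong₂ e₃ (*-cong e₁ e₂) ,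
                      -‿cong₂ (*-congˡ (+-cong e₅ (*-cong e₂ e₂))) (*-cong e₁ e₄) }
      ; from-cong = λ { {⟨ _ , _ , _ , _ , _ ⟩} {⟨ _ , _ , _ , _ , _ ⟩} (e₁ , e₂ , e₃ , e₄ , e₅) →
                      e₁ , e₂ , +-cong e₄ (*-cong e₁ e₂) , e₃ ,
                      -‿cong₂ (*-congˡ (+-cong e₅ (*-cong e₁ e₃))) (*-cong e₂ e₂) }
      ; from∘to   = λ { ⟨ b₁ , b₂ , b₃ , b₄ , b₅ ⟩ →
                      refl , refl , x-y+y≈x b₃ (b₁ * b₂) , refl ,
                      ≈-mod-2h-1 (b₅ + b₂ * b₂) (ψₗφₗ₅ h b₅ (b₂ * b₂) (b₁ * b₄)) }
      ; to∘from   = λ { ⟨ l₁ , l₂ , l₃ , l₄ , l₅ ⟩ →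
                      refl , refl , refl , x+y-y≈x l₄ (l₁ * l₂) ,
                      ≈-mod-2h-1 (l₅ + l₁ * l₃) (φₗψₗ₅ h l₅ (l₂ * l₂) (l₁ * l₃)) }
      }
      where
      ψₗφₗ₅ : ∀ k x y z → (1# + 1#) * ((k * (x + y) - z) + z) - y ≈ x + (x + y) * ((1# + 1#) * k - 1#)
      ψₗφₗ₅ = solve 4 (λ k x y z →
        con (+ 2) :* ((k :* (x :+ y) :- z) :+ z) :- y := x :+ (x :+ y) :* (con (+ 2) :* k :- con (+ 1))) refl

      φₗψₗ₅ : ∀ k x y z → k * (((1# + 1#) * (x + z) - y) + y) - z ≈ x + (x + z) * ((1# + 1#) * k - 1#)
      φₗψₗ₅ = solve 4 (λ k x y z →
        k :* ((con (+ 2) :* (x :+ z) :- y) :+ y) :- z := x :+ (x :+ z) :* (con (+ 2) :* k :- con (+ 1))) refl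

    -- Left: the defect (lhs − rhs) of an equation of D(5,q) at φₚ a, φₗ b.
    -- Right: a combination of the defects of the equations of Γ(q) at a, b.
    δ₂-identity : ∀ a₁ a₂ a₄ b₁ b₂ b₄ →
      ((a₄ - a₁ * a₂) + b₄) - a₁ * b₂ ≈
      ((a₄ + b₄) - (a₁ * a₁) * b₁) + (- a₁) * ((a₂ + b₂) - a₁ * b₁)
    δ₂-identity = solve 6 (λ a₁ a₂ a₄ b₁ b₂ b₄ →
      ((a₄ :- a₁ :* a₂) :+ b₄) :- a₁ :* b₂ :=
      ((a₄ :+ b₄) :- (a₁ :* a₁) :* b₁) :+ (:- a₁) :* ((a₂ :+ b₂) :- a₁ :* b₁)) refl

    δ₃-identity : ∀ a₁ a₂ a₃ b₁ b₂ b₃ →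
      (a₃ + (b₃ - b₁ * b₂)) - a₂ * b₁ ≈
      ((a₃ + b₃) - a₁ * (b₁ * b₁)) + (- b₁) * ((a₂ + b₂) - a₁ * b₁)
    δ₃-identity = solve 6 (λ a₁ a₂ a₃ b₁ b₂ b₃ →
      (a₃ :+ (b₃ :- b₁ :* b₂)) :- a₂ :* b₁ :=
      ((a₃ :+ b₃) :- a₁ :* (b₁ :* b₁)) :+ (:- b₁) :* ((a₂ :+ b₂) :- a₁ :* b₁)) refl

    δ₄-identity : ∀ k a₁ a₂ a₄ a₅ b₁ b₂ b₄ b₅ →
      (k * (a₅ - a₂ * a₂) + (k * (b₅ + b₂ * b₂) - b₁ * b₄)) - (a₄ - a₁ * a₂) * b₁ ≈
      k * ((a₅ + b₅) - (a₁ * a₁) * (b₁ * b₁)) +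
        ((- b₁) * ((a₄ + b₄) - (a₁ * a₁) * b₁) +
         ((k * ((b₂ + a₁ * b₁) - a₂)) * ((a₂ + b₂) - a₁ * b₁) +
          ((a₁ * b₁) * (a₁ * b₁ - a₂)) * ((1# + 1#) * k - 1#)))
    δ₄-identity = solve 9 (λ k a₁ a₂ a₄ a₅ b₁ b₂ b₄ b₅ →
      (k :* (a₅ :- a₂ :* a₂) :+ (k :* (b₅ :+ b₂ :* b₂) :- b₁ :* b₄)) :- (a₄ :- a₁ :* a₂) :* b₁ :=
      k :* ((a₅ :+ b₅) :- (a₁ :* a₁) :* (b₁ :* b₁)) :+
        ((:- b₁) :* ((a₄ :+ b₄) :- (a₁ :* a₁) :* b₁) :+
         ((k :* ((b₂ :+ a₁ :* b₁) :- a₂)) :* ((a₂ :+ b₂) :- a₁ :* b₁) :+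
          ((a₁ :* b₁) :* (a₁ :* b₁ :- a₂)) :* (con (+ 2) :* k :- con (+ 1))))) refl

    incidence : ∀ a b → IncΓ F a b ⇔ IncD F (φₚ a) (φₗ b)
    incidence a@(⟨ a₁ , a₂ , a₃ , a₄ , a₅ ⟩) b@(⟨ b₁ , b₂ , b₃ , b₄ , b₅ ⟩) = mk⇔ forward backward
      where
      γ₁ γ₂ γ₃ γ₄ δ₂ δ₃ δ₄ : Carrier
      γ₁ = (a₂ + b₂) - a₁ * b₁
      γ₂ = (a₃ + b₃) - a₁ * (b₁ * b₁)
      γ₃ = (a₄ + b₄) - (a₁ * a₁) * b₁
      γ₄ = (a₅ + b₅) - (a₁ * a₁) * (b₁ * b₁)
      δ₂ = ((a₄ - a₁ * a₂) + b₄) - a₁ * b₂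
      δ₃ = (a₃ + (b₃ - b₁ * b₂)) - a₂ * b₁
      δ₄ = (h * (a₅ - a₂ * a₂) + (h * (b₅ + b₂ * b₂) - b₁ * b₄)) - (a₄ - a₁ * a₂) * b₁

      δ₂≈γ₃ : γ₁ ≈ 0# → δ₂ ≈ γ₃
      δ₂≈γ₃ γ₁≈0 = ≈+≈0⇒≈ (δ₂-identity a₁ a₂ a₄ b₁ b₂ b₄) (*-≈0 (- a₁) γ₁≈0)

      δ₃≈γ₂ : γ₁ ≈ 0# → δ₃ ≈ γ₂
      δ₃≈γ₂ γ₁≈0 = ≈+≈0⇒≈ (δ₃-identity a₁ a₂ a₃ b₁ b₂ b₃) (*-≈0 (- b₁) γ₁≈0)

      δ₄≈hγ₄ : γ₁ ≈ 0# → γ₃ ≈ 0# → δ₄ ≈ h * γ₄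
      δ₄≈hγ₄ γ₁≈0 γ₃≈0 = ≈+≈0⇒≈ (δ₄-identity h a₁ a₂ a₄ a₅ b₁ b₂ b₄ b₅)
        (+-≈0 (*-≈0 (- b₁) γ₃≈0) (+-≈0 (*-≈0 _ γ₁≈0) (*-≈0 _ 2h-1≈0)))

      forward : IncΓ F a b → IncD F (φₚ a) (φₗ b)
      forward (g₁ , g₂ , g₃ , g₄) =
        g₁ ,
        x-y≈0⇒x≈y _ _ (trans (δ₂≈γ₃ γ₁≈0) γ₃≈0) ,
        x-y≈0⇒x≈y _ _ (trans (δ₃≈γ₂ γ₁≈0) (x≈y⇒x-y≈0 g₂)) ,
        x-y≈0⇒x≈y _ _ (trans (δ₄≈hγ₄ γ₁≈0 γ₃≈0) (*-≈0 h (x≈y⇒x-y≈0 g₄)))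
        where
        γ₁≈0 : γ₁ ≈ 0#
        γ₁≈0 = x≈y⇒x-y≈0 g₁
        γ₃≈0 : γ₃ ≈ 0#
        γ₃≈0 = x≈y⇒x-y≈0 g₃

      backward : IncD F (φₚ a) (φₗ b) → IncΓ F a b
      backward (d₁ , d₂ , d₃ , d₄) =
        d₁ ,
        x-y≈0⇒x≈y _ _ (trans (sym (δ₃≈γ₂ γ₁≈0)) (x≈y⇒x-y≈0 d₃)) ,
        x-y≈0⇒x≈y _ _ γ₃≈0 ,
        x-y≈0⇒x≈y _ _ (h*x≈0⇒x≈0 (trans (sym (δ₄≈hγ₄ γ₁≈0 γ₃≈0)) (x≈y⇒x-y≈0 d₄)))
        where
        γ₁≈0 : γ₁ ≈ 0#
        γ₁≈0 = x≈y⇒x-y≈0 d₁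
        γ₃≈0 : γ₃ ≈ 0#
        γ₃≈0 = trans (sym (δ₂≈γ₃ γ₁≈0)) (x≈y⇒x-y≈0 d₂)

    Γ≅D5 : Isomorphic F (Γ F) (D5 F)
    Γ≅D5 = isomorphic-via pointMap lineMap incidence

lemma2p1 : ∀ {c ℓ : Level} (F : Field c ℓ) (p e : ℕ) →
    Prime p → p ≢ 2 → e ≥ 1 → HasCard F (p ^ e) →
    Isomorphic F (Γ F) (D5 F)
lemma2p1 F p e p-prime p≢2 _ card =
  let open Field F
      (h , 2h≈1) = inverse (1# + 1#) (oddPrime⇒2∤p^e e p-prime p≢2 ∘ 1+1≈0⇒2∣card F card)
  in  ExplicitIsomorphism.Γ≅D5 F h 2h≈1
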